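{- Let $\mathcal F=\{F_n\}$ be any (possibly non-uniform) family of unsatisfiable CNFs with polynomially many clauses, and let $w_0:=w(\mathcal F\vdash_{\mathsf{Res}}\bot)$ be the minimum width of a resolution refutation. Then there exists a (non-uniform) decision-tree reduction of block-depth $2$ from $\textsc{Refuter}(w(\mathcal F\vdash_{\mathsf{Res}}\bot)<w_0)$ to $\mathrm{Iter}$.
   Context: $[N]=\{0,\dots,N-1\}$. Decision-tree reductions: an input $x$ of the source search problem is mapped to an input of the target problem, each output block computed by a decision tree querying $x$, and each solution of the produced instance is mapped by a decision tree on $x$ to a valid solution of $x$; block-depth is the number of distinct input blocks queried. Non-uniform means the trees need not be computable by a single uniform machine. $\mathrm{Iter}$: input $S:[L]\to[L]$; a solution is $x$ with ($x=0$ and $S(0)=0$) or $S(x)<x$ or ($S(x)>x$ and $S(S(x))=S(x)$). Resolution refutations of a CNF with variables $x_1,\dots,x_n$ and axioms $C_{ -m},\dots,C_{ -1}$: a sequence of nodes $C_0,\dots,C_{L-1}$, each containing a set of literals (the clause), a tag "resolution" (with integers $-m\le j,k<i$ and variable index $a$) or "weakening" (with an integer $-m\le j<i$). Node $i$ is valid if for resolution $C_j=x_a\lor D$, $C_k=\overline{x}_a\lor E$, $C_i=D\lor E$ for some clauses $D,E$; for weakening $C_i=C_j\lor D$ for some $D$; and $C_{L-1}=\bot$. Each node is one block. $\textsc{Refuter}(w(F_n\vdash_{\mathsf{Res}}\bot)<w_0)$: the input is a purported resolution refutation of $F_n$ in which each node syntactically holds at most $w_0-1$ literals; a solution is an index of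 a node violating the validity conditions. -}

module Defs where

open import Data.Nat using (ℕ; zero; suc; _+_; _^_; _≤_) renaming (_<_ to _<ℕ_)
open import Data.Fin using (Fin; toℕ; opposite) renaming (_<_ to _<ᶠ_)
import Data.Fin as Fin
open import Data.Bool using (Bool; true; false)
open import Data.Integer using (ℤ; +_; -[1+_])
open import Data.List using (List; []; _∷_; _++_; length; lookup)
open import Data.List.Membership.Propositional using (_∈_)
open import Data.List.Relation.Unary.Any using (Any)
open import Data.List.Relation.Unary.All using (All)
open import Data.Product using (Σ; ∃; _×_; _,_; proj₁)
open import Data.Sum using (_⊎_)
open import Relation.Nullary using (¬_)
open import Relation.Binary.PropositionalEquality using (_≡_)

-- A literal over variables x_0..x_{n-1}: (a , true) is x_a, (a , false) is ¬x_a.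
Lit : ℕ → Set
Lit n = Fin n × Bool

Clause : ℕ → Set
Clause n = List (Lit n)

CNF : ℕ → Set
CNF n = List (Clause n)

-- Clauses are sets of literals: equality of clauses is equality as sets.
_≈_ : ∀ {n} → Clause n → Clause n → Set
C ≈ D = ∀ l → (l ∈ C → l ∈ D) × (l ∈ D → l ∈ C)

Satisfies : ∀ {n} → (Fin n → Bool) → CNF n → Set
Satisfies α F = All (Any (λ l → α (proj₁ l) ≡ Data.Product.proj₂ l)) F

Unsatisfiable : ∀ {n} → CNF n → Set
Unsatisfiable {n} F = ¬ (Σ (Fin n → Bool) λ α → Satisfies α F)

data Rule (n : ℕ) : Set where
  resolution : ℤ → ℤ → Fin n → Rule n
  weakening  : ℤ → Rule n

record Node (n : ℕ) : Set where
  constructor node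
  field
    clause : Clause n
    rule   : Rule n
open Node public

NodeW : ℕ → ℕ → Set
NodeW n w = Σ (Node n) λ b → length (clause b) <ℕ w

-- Ptr F x i j C : in the refutation x (nodes C_0..C_{L-1}) of F with
-- axioms C_{-m}..C_{-1} (C_{-m+s} = s-th clause of F), the integer j
-- satisfies -m ≤ j < i and C_j = C.
data Ptr {n L : ℕ} (F : CNF n) (x : Fin L → Node n) (i : Fin L) : ℤ → Clause n → Set where
  ax : (t : Fin (length F)) → Ptr F x i (-[1+ toℕ t ]) (lookup F (opposite t))
  nd : (k : Fin L) → toℕ k <ℕ toℕ i → Ptr F x i (+ toℕ k) (clause (x k))

RuleOK : ∀ {n L} → CNF n → (Fin L → Node n) → Fin L → Rule n → Set
RuleOK {n} F x i (resolution j k a) =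
  Σ (Clause n) λ Cj → Σ (Clause n) λ Ck → Ptr F x i j Cj × Ptr F x i k Ck ×
  Σ (Clause n) λ D → Σ (Clause n) λ E →
    (Cj ≈ ((a , true) ∷ D)) × (Ck ≈ ((a , false) ∷ E)) × (clause (x i) ≈ (D ++ E))
RuleOK {n} F x i (weakening j) =
  Σ (Clause n) λ Cj → Ptr F x i j Cj × Σ (Clause n) λ D → clause (x i) ≈ (Cj ++ D)

Valid : ∀ {n ℓ} → CNF n → (Fin (suc ℓ) → Node n) → Fin (suc ℓ) → Set
Valid {ℓ = ℓ} F x i = RuleOK F x i (rule (x i)) × (toℕ i ≡ ℓ → clause (x i) ≈ [])

IsMinRefWidth : ∀ {n} → CNF n → ℕ → Set
IsMinRefWidth {n} F w =
  (Σ ℕ λ ℓ → Σ (Fin (suc ℓ) → Node n) λ x →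
     (∀ i → Valid F x i) × (∀ i → length (clause (x i)) ≤ w))
  × ¬ (Σ ℕ λ ℓ → Σ (Fin (suc ℓ) → Node n) λ x →
     (∀ i → Valid F x i) × (∀ i → length (clause (x i)) <ℕ w))

IterSol : ∀ {l'} → (Fin (suc l') → Fin (suc l')) → Fin (suc l') → Set
IterSol S y = (y ≡ Fin.zero × S Fin.zero ≡ Fin.zero)
            ⊎ (S y <ᶠ y)
            ⊎ (y <ᶠ S y × S (S y) ≡ S y)

-- Decision trees over block-structured inputs (I → B), output O,
-- making at most d block queries along any path.

data DT (I B O : Set) : ℕ → Set where
  leaf  : ∀ {d} → O → DT I B O d
  query : ∀ {d} → I → (B → DT I B O d) → DT I B O (suc d)

eval : ∀ {I B O d} → DT I B O d → (I → B) → O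
eval (leaf o)      x = o
eval (query i k)   x = eval (k (x i)) x

DTReduction : ∀ {n} → CNF n → (w ℓ d l' : ℕ) → Set
DTReduction {n} F w ℓ d l' =
  Σ (Fin (suc l') → DT (Fin (suc ℓ)) (NodeW n w) (Fin (suc l')) d) λ T →
  Σ (Fin (suc l') → DT (Fin (suc ℓ)) (NodeW n w) (Fin (suc ℓ)) d) λ O →
  (x : Fin (suc ℓ) → NodeW n w) → (y : Fin (suc l')) →
    IterSol (λ z → eval (T z) x) y → ¬ Valid F (λ i → proj₁ (x i)) (eval (O y) x)

-- Call a clause C t-derivable if it contains an axiom, or t > 0 and either C is
-- (t-1)-derivable or C contains a clause C₀ of width < w such that x_a ∨ C₀ and
-- ¬x_a ∨ C₀ are (t-1)-derivable.  Every derivable clause contains the conclusion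
-- of a derivation of width < w, so when F has no refutation of width < w the empty
-- clause is never derivable.  Node i of the purported refutation becomes the Iter
-- point ℓ - i.  If C_i is (i+1)-derivable the point is fixed; otherwise S jumps to
-- a premise C_p that is not (p+1)-derivable (for a resolution on x_a: the negative
-- premise if x_a ∨ C_i is i-derivable, else the positive one), and a valid node
-- always has such a premise with p < i.  Hence every Iter solution, including the
-- fixed source (the empty last clause), is the point of an invalid node.
module Submission where

open import Defs
open import Data.Nat using (ℕ; suc; _+_; _^_; _≤_)
open import Data.List using (length)
open import Data.Product using (Σ; _×_)

open import Data.Bool using (true; false)
import Data.Bool as Bool
open import Data.Empty using (⊥-elim)
open import Data.Fin using (Fin; toℕ; fromℕ; fromℕ<; opposite) renaming (_<_ to _<ᶠ_)
import Data.Fin.Properties as Fin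
open import Data.Integer using (ℤ; +_; -[1+_])
open import Data.List
  using (List; []; _∷_; _++_; filter; lookup; allFin; cartesianProduct; cartesianProductWith)
open import Data.List.Membership.Propositional using (_∈_)
open import Data.List.Membership.Propositional.Properties
  using (∈-allFin; ∈-cartesianProduct⁺; ∈-cartesianProductWith⁺; ∈-filter⁺; ∈-filter⁻; ∈-++⁻)
open import Data.List.Properties using (length-filter)
open import Data.List.Relation.Binary.Subset.Propositional using (_⊆_)
open import Data.List.Relation.Binary.Subset.Propositional.Properties
  using (⊆-refl; ⊆-trans; ∷⁺ʳ; ⊆∷⇒∈∨⊆; xs⊆xs++ys; xs⊆ys++xs; filter-⊆)
open import Data.List.Relation.Unary.Any using (Any; here; there)
import Data.List.Relation.Unary.Any as Any
open import Data.Nat using (zero; _∸_; _<_; _<?_; _≤?_; _≤′_; ≤′-refl; ≤′-step; z≤n; s≤s; z<s)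
open import Data.Nat.Properties
open import Data.Product using (_,_; proj₁; proj₂)
open import Data.Product.Properties using (≡-dec)
open import Data.Sum using (_⊎_; inj₁; inj₂; [_,_])
open import Function using (_∘_; const)
open import Relation.Binary.Definitions using (DecidableEquality)
open import Relation.Binary.PropositionalEquality using (_≡_; _≢_; refl; sym; trans; cong; subst; subst₂)
open import Relation.Nullary using (¬_; Dec; yes; no)
open import Relation.Nullary.Decidable using (_×-dec_; _⊎-dec_)

module _ {n : ℕ} where

  _≟ˡ_ : DecidableEquality (Lit n)
  _≟ˡ_ = ≡-dec Fin._≟_ Bool._≟_

  open import Data.List.Membership.DecPropositional _≟ˡ_ public using (_∈?_)
  open import Data.List.Relation.Binary.Subset.DecPropositional _≟ˡ_ public using (_⊆?_)

  literals : List (Lit n)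
  literals = cartesianProduct (allFin n) (true ∷ false ∷ [])

  ∈-literals : ∀ l → l ∈ literals
  ∈-literals (a , true)  = ∈-cartesianProduct⁺ (∈-allFin a) (here refl)
  ∈-literals (a , false) = ∈-cartesianProduct⁺ (∈-allFin a) (there (here refl))

  clausesOfWidth≤ : ℕ → List (Clause n)
  clausesOfWidth≤ zero    = [] ∷ []
  clausesOfWidth≤ (suc k) = [] ∷ cartesianProductWith _∷_ literals (clausesOfWidth≤ k)

  ∈-clausesOfWidth≤ : ∀ k (C : Clause n) → length C ≤ k → C ∈ clausesOfWidth≤ k
  ∈-clausesOfWidth≤ zero    []      _         = here refl
  ∈-clausesOfWidth≤ (suc k) []      _         = here refl
  ∈-clausesOfWidth≤ (suc k) (l ∷ C) (s≤s C≤k) =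
    there (∈-cartesianProductWith⁺ _∷_ (∈-literals l) (∈-clausesOfWidth≤ k C C≤k))

  ≈⇒⊆ : {A B : Clause n} → A ≈ B → A ⊆ B
  ≈⇒⊆ A≈B = proj₁ (A≈B _)

  ≈⇒⊇ : {A B : Clause n} → A ≈ B → B ⊆ A
  ≈⇒⊇ A≈B = proj₂ (A≈B _)

  ++-⊆ : {A B C : Clause n} → A ⊆ C → B ⊆ C → A ++ B ⊆ C
  ++-⊆ {A} A⊆C B⊆C = [ A⊆C , B⊆C ] ∘ ∈-++⁻ A

  filter-∈-⊆ : (A C : Clause n) → filter (_∈? C) A ⊆ C
  filter-∈-⊆ A C = proj₂ ∘ ∈-filter⁻ (_∈? C) {xs = A}

  filter-∈-≈ : {A B : Clause n} → A ⊆ B → filter (_∈? A) B ≈ A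
  filter-∈-≈ {A} {B} A⊆B _ = filter-∈-⊆ B A , λ l∈A → ∈-filter⁺ (_∈? A) (A⊆B l∈A) l∈A

  ≈-∷-filter : ∀ {l} {A C : Clause n} → l ∈ A → A ⊆ l ∷ C → A ≈ (l ∷ filter (_∈? C) A)
  ≈-∷-filter {l} {A} {C} l∈A A⊆l∷C l′ = to , from
    where
      to : l′ ∈ A → l′ ∈ l ∷ filter (_∈? C) A
      to l′∈A with A⊆l∷C l′∈A
      ... | here refl = here refl
      ... | there l′∈C = there (∈-filter⁺ (_∈? C) l′∈A l′∈C)
      from : l′ ∈ l ∷ filter (_∈? C) A → l′ ∈ A
      from (here refl) = l∈A
      from (there l′∈A∩C) = proj₁ (∈-filter⁻ (_∈? C) l′∈A∩C)

Premises : ∀ {n} → (ℤ → Clause n → Set) → Clause n → Rule n → Set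
Premises {n} P C (resolution j k a) =
  Σ (Clause n) λ Cj → Σ (Clause n) λ Ck → P j Cj × P k Ck ×
  Σ (Clause n) λ D → Σ (Clause n) λ E →
    (Cj ≈ ((a , true) ∷ D)) × (Ck ≈ ((a , false) ∷ E)) × (C ≈ (D ++ E))
Premises {n} P C (weakening j) =
  Σ (Clause n) λ Cj → P j Cj × Σ (Clause n) λ D → C ≈ (Cj ++ D)

relabel : ∀ {n} → (ℤ → ℤ) → Rule n → Rule n
relabel f (resolution j k a) = resolution (f j) (f k) a
relabel f (weakening j)      = weakening (f j)

module _ {n : ℕ} {P Q : ℤ → Clause n → Set} where

  Premises-map : (∀ {j C} → P j C → Q j C) → ∀ {C} r → Premises P C r → Premises Q C r
  Premises-map f (resolution _ _ _) (Cj , Ck , p , q , rest) = Cj , Ck , f p , f q , rest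
  Premises-map f (weakening _)      (Cj , p , rest)          = Cj , f p , rest

  Premises-relabel : (g : ℤ → ℤ) → (∀ {j C} → P j C → Q (g j) C) →
                     ∀ {C} r → Premises P C r → Premises Q C (relabel g r)
  Premises-relabel g f (resolution _ _ _) (Cj , Ck , p , q , rest) = Cj , Ck , f p , f q , rest
  Premises-relabel g f (weakening _)      (Cj , p , rest)          = Cj , f p , rest

module _ {n ℓ : ℕ} {F : CNF n} {x : Fin (suc ℓ) → Node n} {i : Fin (suc ℓ)} where

  RuleOK⇒Premises : ∀ r → RuleOK F x i r → Premises (Ptr F x i) (clause (x i)) r
  RuleOK⇒Premises (resolution _ _ _) ok = ok
  RuleOK⇒Premises (weakening _)      ok = ok

  Premises⇒RuleOK : ∀ r → Premises (Ptr F x i) (clause (x i)) r → RuleOK F x i r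
  Premises⇒RuleOK (resolution _ _ _) ok = ok
  Premises⇒RuleOK (weakening _)      ok = ok

module _ {ℓ : ℕ} where

  opposite-< : {i j : Fin (suc ℓ)} → i <ᶠ j → opposite j <ᶠ opposite i
  opposite-< {i} {j} i<j rewrite Fin.opposite-prop i | Fin.opposite-prop j =
    ∸-monoʳ-< i<j (≤-pred (Fin.toℕ<n j))

  opposite-<⁻ : {i j : Fin (suc ℓ)} → opposite i <ᶠ opposite j → j <ᶠ i
  opposite-<⁻ {i} {j} o<o =
    subst₂ _<ᶠ_ (Fin.opposite-involutive j) (Fin.opposite-involutive i) (opposite-< o<o)

  opposite-injective : {i j : Fin (suc ℓ)} → opposite i ≡ opposite j → i ≡ j
  opposite-injective {i} {j} eq =
    trans (sym (Fin.opposite-involutive i)) (trans (cong opposite eq) (Fin.opposite-involutive j))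

  IterSolᵒᵖ : (Fin (suc ℓ) → Fin (suc ℓ)) → Fin (suc ℓ) → Set
  IterSolᵒᵖ f i = (i ≡ fromℕ ℓ × f i ≡ i) ⊎ (i <ᶠ f i) ⊎ (f i <ᶠ i × f (f i) ≡ f i)

  IterSol-opposite : ∀ f y → IterSol (opposite ∘ f ∘ opposite) y → IterSolᵒᵖ f (opposite y)
  IterSol-opposite f y (inj₁ (refl , fixed)) =
    inj₁ (refl , opposite-injective (trans fixed (sym (Fin.opposite-involutive Fin.zero))))
  IterSol-opposite f y (inj₂ (inj₁ Sy<y)) =
    inj₂ (inj₁ (opposite-<⁻ (subst (opposite (f (opposite y)) <ᶠ_) (sym (Fin.opposite-involutive y))
                                   Sy<y)))
  IterSol-opposite f y (inj₂ (inj₂ (y<Sy , fixed))) =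
    inj₂ (inj₂ (opposite-<⁻ (subst (_<ᶠ opposite (f (opposite y))) (sym (Fin.opposite-involutive y))
                                   y<Sy) ,
                opposite-injective (subst (λ z → opposite (f z) ≡ opposite (f (opposite y)))
                                          (Fin.opposite-involutive _) fixed)))

module _ {n : ℕ} (F : CNF n) (w : ℕ) where

  axiom : Fin (length F) → Clause n
  axiom t = lookup F (opposite t)

  Derivable : ℕ → Clause n → Set
  Derivable zero    C = Σ (Fin (length F)) λ s → axiom s ⊆ C
  Derivable (suc t) C = Derivable t C ⊎ Any (λ C₀ → C₀ ⊆ C × length C₀ < w ×
    Σ (Fin n) λ a → Derivable t ((a , true) ∷ C₀) × Derivable t ((a , false) ∷ C₀))
    (clausesOfWidth≤ w)

  derivable? : ∀ t C → Dec (Derivable t C)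
  derivable? zero    C = Fin.any? λ s → axiom s ⊆? C
  derivable? (suc t) C = derivable? t C ⊎-dec Any.any? (λ C₀ → C₀ ⊆? C ×-dec suc (length C₀) ≤? w ×-dec
    Fin.any? λ a → derivable? t ((a , true) ∷ C₀) ×-dec derivable? t ((a , false) ∷ C₀))
    (clausesOfWidth≤ w)

  Derivable-⊆ : ∀ t {C C′} → C ⊆ C′ → Derivable t C → Derivable t C′
  Derivable-⊆ zero    C⊆C′ (s , ax⊆C) = s , ⊆-trans ax⊆C C⊆C′
  Derivable-⊆ (suc t) C⊆C′ (inj₁ d)   = inj₁ (Derivable-⊆ t C⊆C′ d)
  Derivable-⊆ (suc t) C⊆C′ (inj₂ r)   =
    inj₂ (Any.map (λ (C₀⊆C , rest) → (λ {_} → ⊆-trans C₀⊆C C⊆C′) , rest) r)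

  Derivable-mono : ∀ {t t′ C} → t ≤ t′ → Derivable t C → Derivable t′ C
  Derivable-mono {C = C} = go ∘ ≤⇒≤′
    where
      go : ∀ {t t′} → t ≤′ t′ → Derivable t C → Derivable t′ C
      go ≤′-refl       d = d
      go (≤′-step t≤t′) d = inj₁ (go t≤t′ d)

  Derivable-axiom : ∀ t s → Derivable t (axiom s)
  Derivable-axiom t s = Derivable-mono z≤n (s , ⊆-refl)

  Derivable-resolve : ∀ t {C} a → length C < w →
    Derivable t ((a , true) ∷ C) → Derivable t ((a , false) ∷ C) → Derivable (suc t) C
  Derivable-resolve t {C} a C<w d⁺ d⁻ =
    inj₂ (Any.map (λ { refl → (λ {_} → ⊆-refl) , C<w , a , d⁺ , d⁻ })
                  (∈-clausesOfWidth≤ w C (<⇒≤ C<w)))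

  -- Derivations are indexed by ℕ, their size kept apart, so that they can be concatenated;
  -- truncate turns one back into a refutation in the Fin-indexed format of Defs.
  data Pointer (x : ℕ → Node n) (i : ℕ) : ℤ → Clause n → Set where
    toAxiom : (s : Fin (length F)) → Pointer x i -[1+ toℕ s ] (axiom s)
    toNode  : (k : ℕ) → k < i → Pointer x i (+ k) (clause (x k))

  NarrowNodeAt : (ℕ → Node n) → ℕ → Node n → Set
  NarrowNodeAt x i b = Premises (Pointer x i) (clause b) (rule b) × length (clause b) < w

  NarrowDerivation : (ℕ → Node n) → ℕ → Set
  NarrowDerivation x L = ∀ i → i < L → NarrowNodeAt x i (x i)

  Pointer-≤ : ∀ {x i i′ j C} → i ≤ i′ → Pointer x i j C → Pointer x i′ j C
  Pointer-≤ i≤i′ (toAxiom s)   = toAxiom s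
  Pointer-≤ i≤i′ (toNode k k<i) = toNode k (<-≤-trans k<i i≤i′)

  Pointer-agree : ∀ {x y i j C} → (∀ k → k < i → x k ≡ y k) → Pointer x i j C → Pointer y i j C
  Pointer-agree x≡y (toAxiom s)   = toAxiom s
  Pointer-agree {y = y} {i} x≡y (toNode k k<i) =
    subst (Pointer y i (+ k)) (cong clause (sym (x≡y k k<i))) (toNode k k<i)

  infixr 5 _++[_]_
  _++[_]_ : (ℕ → Node n) → ℕ → (ℕ → Node n) → ℕ → Node n
  (x ++[ L ] y) m with m <? L
  ... | yes _ = x m
  ... | no _  = y (m ∸ L)

  ++-lower : ∀ x L y {m} → m < L → (x ++[ L ] y) m ≡ x m
  ++-lower x L y {m} m<L with m <? L
  ... | yes _   = refl
  ... | no m≮L = ⊥-elim (m≮L m<L)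

  ++-upper : ∀ x L y m → (x ++[ L ] y) (L + m) ≡ y m
  ++-upper x L y m with L + m <? L
  ... | yes L+m<L = ⊥-elim (m+n≮m L m L+m<L)
  ... | no _      = cong y (m+n∸m≡n L m)

  shiftIndex : ℕ → ℤ → ℤ
  shiftIndex L (+ k)     = + (L + k)
  shiftIndex L -[1+ s ] = -[1+ s ]

  shift : ℕ → Node n → Node n
  shift L b = node (clause b) (relabel (shiftIndex L) (rule b))

  Pointer-++ˡ : ∀ {x L y} M {j C} → Pointer x L j C → Pointer (x ++[ L ] y) (L + M) j C
  Pointer-++ˡ {x} {L} {y} M =
    Pointer-≤ (m≤m+n L M) ∘ Pointer-agree (λ k k<L → sym (++-lower x L y k<L))

  Pointer-++ʳ : ∀ {x L y m j C} → Pointer y m j C →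
    Pointer (x ++[ L ] shift L ∘ y) (L + m) (shiftIndex L j) C
  Pointer-++ʳ (toAxiom s) = toAxiom s
  Pointer-++ʳ {x} {L} {y} {m} (toNode k k<m) =
    subst (Pointer _ (L + m) (+ (L + k))) (cong clause (++-upper x L (shift L ∘ y) k))
      (toNode (L + k) (+-monoʳ-< L k<m))

  Pointer-snoc : ∀ x L b → Pointer (x ++[ L ] const b) (L + 1) (+ (L + 0)) (clause b)
  Pointer-snoc x L b =
    subst (Pointer _ (L + 1) _) (cong clause (++-upper x L (const b) 0)) (toNode (L + 0) (+-monoʳ-< L z<s))

  ++-narrow : ∀ {x L y M} → NarrowDerivation x L →
    (∀ m → m < M → NarrowNodeAt (x ++[ L ] y) (L + m) (y m)) →
    NarrowDerivation (x ++[ L ] y) (L + M)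
  ++-narrow {x} {L} {y} {M} narrowˣ narrowʸ i i<L+M with i <? L
  ... | yes i<L =
    Premises-map (Pointer-agree λ k k<i → sym (++-lower x L y (<-trans k<i i<L))) (rule (x i))
      (proj₁ (narrowˣ i i<L)) ,
    proj₂ (narrowˣ i i<L)
  ... | no i≮L with m , refl ← m≤n⇒∃[o]m+o≡n (≮⇒≥ i≮L) rewrite m+n∸m≡n L m =
    narrowʸ m (+-cancelˡ-< L m M i<L+M)

  cat-narrow : ∀ {x L y M} → NarrowDerivation x L → NarrowDerivation y M →
    NarrowDerivation (x ++[ L ] shift L ∘ y) (L + M)
  cat-narrow {y = y} narrowˣ narrowʸ = ++-narrow narrowˣ λ m m<M →
    Premises-relabel (shiftIndex _) Pointer-++ʳ (rule (y m)) (proj₁ (narrowʸ m m<M)) ,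
    proj₂ (narrowʸ m m<M)

  snoc-narrow : ∀ {x L} b → NarrowDerivation x L → NarrowNodeAt x L b →
    NarrowDerivation (x ++[ L ] const b) (L + 1)
  snoc-narrow b narrowˣ (premises , b<w) = ++-narrow narrowˣ λ
    { zero    _          → Premises-map (Pointer-++ˡ 0) (rule b) premises , b<w
    ; (suc _) (s≤s ()) }

  record Covered (C : Clause n) : Set where
    constructor covered
    field
      size        : ℕ
      nodes       : ℕ → Node n
      narrow      : NarrowDerivation nodes size
      index       : ℤ
      conclusion  : Clause n
      pointer     : Pointer nodes size index conclusion
      conclusion⊆ : conclusion ⊆ C

  Covered-⊆ : ∀ {C C′} → C ⊆ C′ → Covered C → Covered C′
  Covered-⊆ C⊆C′ (covered L x narrowˣ j c p c⊆C) = covered L x narrowˣ j c p (⊆-trans c⊆C C⊆C′)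

  Covered-resolve : ∀ {C₀} a → length C₀ < w →
    Covered ((a , true) ∷ C₀) → Covered ((a , false) ∷ C₀) → Covered C₀
  Covered-resolve {C₀} a C₀<w
    (covered L₁ x₁ narrow₁ j₁ c₁ p₁ c₁⊆) (covered L₂ x₂ narrow₂ j₂ c₂ p₂ c₂⊆)
    with ⊆∷⇒∈∨⊆ c₁⊆ | ⊆∷⇒∈∨⊆ c₂⊆
  ... | inj₂ c₁⊆C₀  | _          = covered L₁ x₁ narrow₁ j₁ c₁ p₁ c₁⊆C₀
  ... | inj₁ _      | inj₂ c₂⊆C₀ = covered L₂ x₂ narrow₂ j₂ c₂ p₂ c₂⊆C₀
  ... | inj₁ pos∈c₁ | inj₁ neg∈c₂ =
    covered (L + 1) (x ++[ L ] const b) (snoc-narrow b (cat-narrow narrow₁ narrow₂) (premises , R<w))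
      _ R (Pointer-snoc x L b) (filter-⊆ _ C₀)
    where
      L : ℕ
      L = L₁ + L₂
      x : ℕ → Node n
      x = x₁ ++[ L₁ ] shift L₁ ∘ x₂
      D E R : Clause n
      D = filter (_∈? C₀) c₁
      E = filter (_∈? C₀) c₂
      -- The resolvent D ∨ E is stored as a sublist of C₀, so its width stays below w.
      R = filter (_∈? D ++ E) C₀
      b : Node n
      b = node R (resolution j₁ (shiftIndex L₁ j₂) a)
      premises : Premises (Pointer x L) R (rule b)
      premises = c₁ , c₂ , Pointer-++ˡ L₂ p₁ , Pointer-++ʳ p₂ , D , E ,
        ≈-∷-filter pos∈c₁ c₁⊆ , ≈-∷-filter neg∈c₂ c₂⊆ ,
        filter-∈-≈ (++-⊆ (filter-∈-⊆ c₁ C₀) (filter-∈-⊆ c₂ C₀))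
      R<w : length R < w
      R<w = ≤-<-trans (length-filter _ C₀) C₀<w

  Derivable-sound : ∀ t {C} → Derivable t C → Covered C
  Derivable-sound zero (s , ax⊆C) =
    covered 0 (const (node [] (weakening (+ 0)))) (λ _ ()) _ (axiom s) (toAxiom s) ax⊆C
  Derivable-sound (suc t) (inj₁ d) = Derivable-sound t d
  Derivable-sound (suc t) (inj₂ r) with C₀ , C₀⊆C , C₀<w , a , d⁺ , d⁻ ← Any.satisfied r =
    Covered-⊆ C₀⊆C (Covered-resolve a C₀<w (Derivable-sound t d⁺) (Derivable-sound t d⁻))

  NarrowRefutation : Set
  NarrowRefutation = Σ ℕ λ ℓ → Σ (Fin (suc ℓ) → Node n) λ x →
    (∀ i → Valid F x i) × (∀ i → length (clause (x i)) < w)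

  Pointer⇒Ptr : ∀ {x k} (i : Fin (suc k)) {j C} → Pointer x (toℕ i) j C → Ptr F (x ∘ toℕ) i j C
  Pointer⇒Ptr i (toAxiom s) = ax s
  Pointer⇒Ptr {x} {k} i (toNode m m<i) =
    subst (λ m′ → Ptr F (x ∘ toℕ) i (+ m′) (clause (x m′))) (Fin.toℕ-fromℕ< m<k+1)
      (nd (fromℕ< m<k+1) (subst (_< toℕ i) (sym (Fin.toℕ-fromℕ< m<k+1)) m<i))
    where
      m<k+1 : m < suc k
      m<k+1 = <-trans m<i (Fin.toℕ<n i)

  truncate : ∀ {x M} k → NarrowDerivation x M → k < M → clause (x k) ≡ [] → NarrowRefutation
  truncate {x} {M} k narrowˣ k<M x[k]≡[] =
    k , x ∘ toℕ , (λ i → valid i , lastEmpty i) , λ i → proj₂ (narrowˣ (toℕ i) (i<M i))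
    where
      i<M : ∀ (i : Fin (suc k)) → toℕ i < M
      i<M i = ≤-<-trans (≤-pred (Fin.toℕ<n i)) k<M
      valid : ∀ i → RuleOK F (x ∘ toℕ) i (rule (x (toℕ i)))
      valid i = Premises⇒RuleOK (rule (x (toℕ i)))
        (Premises-map (Pointer⇒Ptr i) (rule (x (toℕ i))) (proj₁ (narrowˣ (toℕ i) (i<M i))))
      lastEmpty : ∀ (i : Fin (suc k)) → toℕ i ≡ k → clause (x (toℕ i)) ≈ []
      lastEmpty i i≡k rewrite i≡k | x[k]≡[] = λ _ → (λ ()) , (λ ())

  Covered-[]⇒refutation : 0 < w → Covered [] → NarrowRefutation
  Covered-[]⇒refutation 0<w (covered L x narrowˣ j c p c⊆[]) =
    truncate (L + 0) (snoc-narrow b narrowˣ (premises , 0<w)) (+-monoʳ-< L z<s)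
      (cong clause (++-upper x L (const b) 0))
    where
      b : Node n
      b = node [] (weakening j)
      premises : Premises (Pointer x L) [] (weakening j)
      premises = c , p , [] , λ _ → (λ ()) , ++-⊆ c⊆[] ⊆-refl

  empty-underivable : 0 < w → ¬ NarrowRefutation → ∀ t {C} → C ≈ [] → ¬ Derivable t C
  empty-underivable 0<w noRefutation t C≈[] =
    noRefutation ∘ Covered-[]⇒refutation 0<w ∘ Covered-⊆ (≈⇒⊆ C≈[]) ∘ Derivable-sound t

  chosenPremise : ℕ → Clause n → Rule n → ℤ
  chosenPremise i C (weakening j) = j
  chosenPremise i C (resolution j k a) with derivable? i ((a , true) ∷ C)
  ... | yes _ = k
  ... | no _  = j

  chosenPremise-underivable : ∀ {P : ℤ → Clause n → Set} i {C} r → Premises P C r →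
    length C < w → ¬ Derivable (suc i) C →
    Σ (Clause n) λ C′ → P (chosenPremise i C r) C′ × ¬ Derivable i C′
  chosenPremise-underivable i (weakening j) (Cj , pj , D , C≈) _ ¬d =
    Cj , pj , λ dj → ¬d (inj₁ (Derivable-⊆ i (⊆-trans (xs⊆xs++ys Cj D) (≈⇒⊇ C≈)) dj))
  chosenPremise-underivable i {C} (resolution j k a) (Cj , Ck , pj , pk , D , E , Cj≈ , Ck≈ , C≈) C<w ¬d
    with derivable? i ((a , true) ∷ C)
  ... | yes d⁺ = Ck , pk , λ dk → ¬d (Derivable-resolve i a C<w d⁺
    (Derivable-⊆ i (⊆-trans (≈⇒⊆ Ck≈) (∷⁺ʳ _ (⊆-trans (xs⊆ys++xs E D) (≈⇒⊇ C≈)))) dk))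
  ... | no ¬d⁺ = Cj , pj , λ dj → ¬d⁺
    (Derivable-⊆ i (⊆-trans (≈⇒⊆ Cj≈) (∷⁺ʳ _ (⊆-trans (xs⊆xs++ys D E) (≈⇒⊇ C≈)))) dj)

  module _ {ℓ : ℕ} where

    target : Fin (suc ℓ) → ℤ → Fin (suc ℓ)
    target i (+ m) with m <? toℕ i
    ... | yes m<i = fromℕ< (<-trans m<i (Fin.toℕ<n i))
    ... | no _    = fromℕ ℓ
    target i -[1+ _ ] = fromℕ ℓ

    target-toNode : ∀ i k → k <ᶠ i → target i (+ toℕ k) ≡ k
    target-toNode i k k<i with toℕ k <? toℕ i
    ... | yes _   = Fin.fromℕ<-toℕ k _
    ... | no k≮i = ⊥-elim (k≮i k<i)

    target-<-or-last : ∀ i j → target i j <ᶠ i ⊎ target i j ≡ fromℕ ℓ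
    target-<-or-last i (+ m) with m <? toℕ i
    ... | yes m<i = inj₁ (subst (_< toℕ i) (sym (Fin.toℕ-fromℕ< _)) m<i)
    ... | no _    = inj₂ refl
    target-<-or-last i -[1+ _ ] = inj₂ refl

    next : Fin (suc ℓ) → Node n → Fin (suc ℓ)
    next i b with derivable? (suc (toℕ i)) (clause b)
    ... | yes _ = i
    ... | no _  = target i (chosenPremise (toℕ i) (clause b) (rule b))

    next-derivable : ∀ i b → Derivable (suc (toℕ i)) (clause b) → next i b ≡ i
    next-derivable i b d with derivable? (suc (toℕ i)) (clause b)
    ... | yes _  = refl
    ... | no ¬d = ⊥-elim (¬d d)

    next-underivable : ∀ i b → ¬ Derivable (suc (toℕ i)) (clause b) →
      next i b ≡ target i (chosenPremise (toℕ i) (clause b) (rule b))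
    next-underivable i b ¬d with derivable? (suc (toℕ i)) (clause b)
    ... | yes d = ⊥-elim (¬d d)
    ... | no _  = refl

    Underivable : (Fin (suc ℓ) → Node n) → Fin (suc ℓ) → Set
    Underivable x i = ¬ Derivable (suc (toℕ i)) (clause (x i))

    moved⇒Underivable : ∀ x i → next i (x i) ≢ i → Underivable x i
    moved⇒Underivable x i moved = moved ∘ next-derivable i (x i)

    Ptr-target-Underivable : ∀ x i {j C} → Ptr F x i j C → ¬ Derivable (toℕ i) C →
      target i j <ᶠ i × Underivable x (target i j)
    Ptr-target-Underivable x i (ax s) ¬d = ⊥-elim (¬d (Derivable-axiom (toℕ i) s))
    Ptr-target-Underivable x i (nd k k<i) ¬d rewrite target-toNode i k k<i = k<i , ¬d ∘ Derivable-mono k<i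

    next-descends : ∀ x i → RuleOK F x i (rule (x i)) → length (clause (x i)) < w → Underivable x i →
      next i (x i) <ᶠ i × Underivable x (next i (x i))
    next-descends x i ok narrow underivable
      rewrite next-underivable i (x i) underivable
      with _ , p , ¬d ← chosenPremise-underivable (toℕ i) (rule (x i)) (RuleOK⇒Premises (rule (x i)) ok)
                          narrow underivable
      = Ptr-target-Underivable x i p ¬d

    Underivable-fixed⇒last : ∀ x p → Underivable x p → next p (x p) ≡ p → p ≡ fromℕ ℓ
    Underivable-fixed⇒last x p underivable fixed
      with target-<-or-last p (chosenPremise (toℕ p) (clause (x p)) (rule (x p)))
         | trans (sym (next-underivable p (x p) underivable)) fixed
    ... | inj₁ t<p    | t≡p = ⊥-elim (<-irrefl (cong toℕ t≡p) t<p)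
    ... | inj₂ t≡last | t≡p = trans (sym t≡p) t≡last

    valid⇒¬IterSolᵒᵖ : ¬ NarrowRefutation → ∀ x i → Valid F x i → length (clause (x i)) < w →
      ¬ IterSolᵒᵖ (λ p → next p (x p)) i
    valid⇒¬IterSolᵒᵖ noRefutation x i (ok , lastEmpty) narrow (inj₁ (refl , fixed)) =
      <-irrefl (cong toℕ fixed) (proj₁ (next-descends x i ok narrow underivable))
      where
        underivable : Underivable x i
        underivable =
          empty-underivable (≤-<-trans z≤n narrow) noRefutation _ (lastEmpty (Fin.toℕ-fromℕ ℓ))
    valid⇒¬IterSolᵒᵖ _ x i (ok , _) narrow (inj₂ (inj₁ i<next)) =
      <-asym i<next
        (proj₁ (next-descends x i ok narrow (moved⇒Underivable x i (<⇒≢ i<next ∘ cong toℕ ∘ sym))))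
    valid⇒¬IterSolᵒᵖ _ x i (ok , _) narrow (inj₂ (inj₂ (next<i , fixed)))
      with p<i , underivableᵖ ←
             next-descends x i ok narrow (moved⇒Underivable x i (<⇒≢ next<i ∘ cong toℕ)) =
      <-irrefl (trans (cong toℕ (Underivable-fixed⇒last x _ underivableᵖ fixed)) (Fin.toℕ-fromℕ ℓ))
               (<-≤-trans p<i (≤-pred (Fin.toℕ<n i)))

    reduction : ¬ NarrowRefutation → DTReduction F w ℓ 2 ℓ
    reduction noRefutation = T , O , λ x y sol valid →
      valid⇒¬IterSolᵒᵖ noRefutation (proj₁ ∘ x) (opposite y) valid (proj₂ (x (opposite y)))
        (IterSol-opposite (λ i → next i (proj₁ (x i))) y sol)
      where
        T : Fin (suc ℓ) → DT (Fin (suc ℓ)) (NodeW n w) (Fin (suc ℓ)) 2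
        T z = query (opposite z) λ b → leaf (opposite (next (opposite z) (proj₁ b)))
        O : Fin (suc ℓ) → DT (Fin (suc ℓ)) (NodeW n w) (Fin (suc ℓ)) 2
        O y = leaf (opposite y)

mainTheorem6 : (F : (n : ℕ) → CNF n)
    → (∀ n → Unsatisfiable (F n))
    → Σ ℕ (λ c → ∀ n → length (F n) ≤ (2 + n) ^ c)
    → (w₀ : ℕ → ℕ) → (∀ n → IsMinRefWidth (F n) (w₀ n))
    → Σ ℕ (λ c → ∀ n ℓ → Σ ℕ (λ l' →
         (suc l' ≤ (2 + n + ℓ) ^ c) × DTReduction (F n) (w₀ n) ℓ 2 l'))
mainTheorem6 F _ _ w₀ minWidth = 1 , λ n ℓ →
  ℓ , size-bound n ℓ , reduction (F n) (w₀ n) (proj₂ (minWidth n))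
  where
    size-bound : ∀ n ℓ → suc ℓ ≤ (2 + n + ℓ) ^ 1
    size-bound n ℓ rewrite ^-identityʳ (2 + n + ℓ) = s≤s (≤-trans (m≤n+m ℓ n) (n≤1+n (n + ℓ)))
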